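{- For non-negative integers $n$ and $\ell$, and real number $\alpha$, $$\bar{B}_{\alpha}(n+\ell;x)=\sum_{j=0}^{\ell}\sum_{k=0}^nS_{\alpha}(\ell,j)\binom{n}{k}j^{n-k}\bar{B}_{\alpha}(k;x)\,x^j$$ and $$\bar{B}_{\alpha}(n+\ell)=\sum_{j=0}^{\ell}\sum_{k=0}^nS_{\alpha}(\ell,j)\binom{n}{k}j^{n-k}\bar{B}_{\alpha}(k).$$
   Context: For real $\alpha$, the non-central Stirling numbers of the second kind $S_\alpha(n,k)$ ($n,k\ge0$ integers) are the coefficients in $(t-\alpha)^n=\sum_{k=0}^nS_\alpha(n,k)(t)_k$, where $(t)_k=t(t-1)\cdots(t-k+1)$. The non-central Bell polynomials are $\bar{B}_{\alpha}(n;x)=\sum_{k=0}^nS_\alpha(n,k)x^k$ and the non-central Bell numbers are $\bar{B}_{\alpha}(n)=\bar B_\alpha(n;1)=\sum_{k=0}^nS_\alpha(n,k)$. The convention $0^0=1$ is used. -}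

module Defs where

open import Level using (Level)
open import Data.Nat using (ℕ; zero; suc; _∸_) renaming (_*_ to _*ℕ_; _^_ to _^ℕ_)
open import Data.Nat.Combinatorics using (_C_)
open import Algebra.Bundles using (CommutativeRing; Semiring)

-- Non-central Stirling numbers and Bell polynomials over an arbitrary
-- commutative ring R (the paper works over the reals).
module NonCentral {c ℓ : Level} (R : CommutativeRing c ℓ) where
  open CommutativeRing R hiding (zero)
  open import Algebra.Definitions.RawSemiring (Semiring.rawSemiring semiring)
    using (_×_)
  open import Algebra.Definitions.RawSemiring (Semiring.rawSemiring semiring) public
    using (_^_)

  ι : ℕ → Carrier
  ι n = n × 1#

  sumTo : ℕ → (ℕ → Carrier) → Carrier
  sumTo zero    f = f 0
  sumTo (suc n) f = sumTo n f + f (suc n)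

  falling : Carrier → ℕ → Carrier
  falling t zero    = 1#
  falling t (suc k) = falling t k * (t - ι k)

  -- S_α(n,k): defined by the recurrence obtained from
  -- (t-α)^{n+1} = (t-α) Σ_k S_α(n,k)(t)_k and t (t)_k = (t)_{k+1} + k (t)_k.
  S : Carrier → ℕ → ℕ → Carrier
  S α zero    zero    = 1#
  S α zero    (suc k) = 0#
  S α (suc n) zero    = (- α) * S α n zero
  S α (suc n) (suc k) = S α n k + (ι (suc k) - α) * S α n (suc k)

  bellPoly : Carrier → ℕ → Carrier → Carrier
  bellPoly α n x = sumTo n (λ k → S α n k * (x ^ k))

  bell : Carrier → ℕ → Carrier
  bell α n = sumTo n (λ k → S α n k)

{-# OPTIONS --safe #-}
-- Identify a sequence F with the polynomial Σₖ F k (t)ₖ, so that S α n is (t - α)ⁿ.  Since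
-- (t)ⱼ (t - j)ₖ = (t)ⱼ₊ₖ, shifting a sequence by j turns multiplication by t - (α - j) into
-- multiplication by t - α; expanding (t - α)ⁿ⁺ˡ = Σⱼ S_α(l, j) (t - α)ⁿ (t)ⱼ therefore gives
-- S_α(n + l, m) = Σⱼ S_α(l, j) S_{α-j}(n, m - j), and summing against xᵐ gives
-- B̄_α(n + l; x) = Σⱼ S_α(l, j) xʲ B̄_{α-j}(n; x).  Finally (t - α + j)ⁿ = Σₖ C(n,k) jⁿ⁻ᵏ (t - α)ᵏ
-- rewrites B̄_{α-j}(n; x) in terms of the B̄_α(k; x).
module Submission where

open import Defs
open import Level using (Level)
open import Data.Nat using (ℕ; zero; suc; _∸_; _≤_; _<_; _≤′_; ≤′-refl; ≤′-step; z≤n; s≤s)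
  renaming (_+_ to _+ℕ_; _*_ to _*ℕ_; _^_ to _^ℕ_)
import Data.Nat.Properties as ℕ
open import Data.Nat.Combinatorics using (_C_; nCk+nC[k+1]≡[n+1]C[k+1]; k>n⇒nCk≡0)
open import Data.Product using (_×_; _,_)
open import Data.Sum using (inj₁; inj₂)
open import Data.Maybe using (nothing)
open import Algebra.Bundles using (CommutativeRing)
import Relation.Binary.PropositionalEquality as ≡
open import Tactic.RingSolver.Core.AlmostCommutativeRing using (fromCommutativeRing)

module NonCentralProperties {c ℓ : Level} (R : CommutativeRing c ℓ) where
  open CommutativeRing R hiding (zero)
  open NonCentral R
  open import Relation.Binary.Reasoning.Setoid setoid
  open import Algebra.Properties.Group +-group using () renaming (ε⁻¹≈ε to -0#≈0#)
  open import Algebra.Properties.AbelianGroup +-abelianGroup using () renaming (⁻¹-anti-homo‿- to -[x-y]≈y-x)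
  open import Algebra.Properties.CommutativeSemigroup *-commutativeSemigroup using (x∙yz≈y∙xz)
  open import Algebra.Properties.Semiring.Mult semiring using (×-homo-+; ×1-homo-*)
  open import Tactic.RingSolver.NonReflective (fromCommutativeRing R (λ _ → nothing))

  VanishesAbove : ℕ → (ℕ → Carrier) → Set ℓ
  VanishesAbove n f = ∀ k → n < k → f k ≈ 0#

  infix 4 _≋_
  _≋_ : (ℕ → Carrier) → (ℕ → Carrier) → Set ℓ
  F ≋ G = ∀ m → F m ≈ G m

  sumTo-congᵇ : ∀ n {f g : ℕ → Carrier} → (∀ k → k ≤ n → f k ≈ g k) → sumTo n f ≈ sumTo n g
  sumTo-congᵇ zero    f≈g = f≈g 0 z≤n
  sumTo-congᵇ (suc n) f≈g =
    +-cong (sumTo-congᵇ n (λ k k≤n → f≈g k (ℕ.m≤n⇒m≤1+n k≤n))) (f≈g (suc n) ℕ.≤-refl)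

  sumTo-cong : ∀ n {f g : ℕ → Carrier} → f ≋ g → sumTo n f ≈ sumTo n g
  sumTo-cong n f≈g = sumTo-congᵇ n (λ k _ → f≈g k)

  sumTo-zero : ∀ n {f : ℕ → Carrier} → (∀ k → k ≤ n → f k ≈ 0#) → sumTo n f ≈ 0#
  sumTo-zero zero    f≈0 = f≈0 0 z≤n
  sumTo-zero (suc n) f≈0 = trans
    (+-cong (sumTo-zero n (λ k k≤n → f≈0 k (ℕ.m≤n⇒m≤1+n k≤n))) (f≈0 (suc n) ℕ.≤-refl))
    (+-identityʳ 0#)

  sumTo-+ : ∀ n (f g : ℕ → Carrier) → sumTo n (λ k → f k + g k) ≈ sumTo n f + sumTo n g
  sumTo-+ zero    f g = refl
  sumTo-+ (suc n) f g = trans (+-congʳ (sumTo-+ n f g))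
    (solve 4 (λ a b x y → ((a ⊕ b) ⊕ (x ⊕ y)) ⊜ ((a ⊕ x) ⊕ (b ⊕ y))) refl
      (sumTo n f) (sumTo n g) (f (suc n)) (g (suc n)))

  *-distribˡ-sumTo : ∀ n x (f : ℕ → Carrier) → x * sumTo n f ≈ sumTo n (λ k → x * f k)
  *-distribˡ-sumTo zero    x f = refl
  *-distribˡ-sumTo (suc n) x f = trans (distribˡ x _ _) (+-congʳ (*-distribˡ-sumTo n x f))

  *-distribʳ-sumTo : ∀ n x (f : ℕ → Carrier) → sumTo n f * x ≈ sumTo n (λ k → f k * x)
  *-distribʳ-sumTo zero    x f = refl
  *-distribʳ-sumTo (suc n) x f = trans (distribʳ x _ _) (+-congʳ (*-distribʳ-sumTo n x f))

  sumTo-comm : ∀ m n (f : ℕ → ℕ → Carrier) →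
    sumTo m (λ i → sumTo n (f i)) ≈ sumTo n (λ j → sumTo m (λ i → f i j))
  sumTo-comm zero    n f = refl
  sumTo-comm (suc m) n f = trans (+-congʳ (sumTo-comm m n f)) (sym (sumTo-+ n _ (f (suc m))))

  sumTo-suc-head : ∀ n (f : ℕ → Carrier) → sumTo (suc n) f ≈ f 0 + sumTo n (λ k → f (suc k))
  sumTo-suc-head zero    f = refl
  sumTo-suc-head (suc n) f = trans (+-congʳ (sumTo-suc-head n f)) (+-assoc _ _ _)

  sumTo-pad : ∀ {m n} (f : ℕ → Carrier) → VanishesAbove m f → m ≤ n → sumTo n f ≈ sumTo m f
  sumTo-pad {m} f f≈0 m≤n = pad (ℕ.≤⇒≤′ m≤n)
    where
    pad : ∀ {n} → m ≤′ n → sumTo n f ≈ sumTo m f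
    pad ≤′-refl        = refl
    pad (≤′-step m≤′n) = trans (+-cong (pad m≤′n) (f≈0 _ (s≤s (ℕ.≤′⇒≤ m≤′n))))
                               (+-identityʳ _)

  shift : (ℕ → Carrier) → ℕ → Carrier
  shift F zero    = 0#
  shift F (suc m) = F m

  shiftBy : ℕ → (ℕ → Carrier) → ℕ → Carrier
  shiftBy zero    F = F
  shiftBy (suc j) F = shift (shiftBy j F)

  shift-cong : ∀ {F G} → F ≋ G → shift F ≋ shift G
  shift-cong F≈G zero    = refl
  shift-cong F≈G (suc m) = F≈G m

  shiftBy-cong : ∀ j {F G} → F ≋ G → shiftBy j F ≋ shiftBy j G
  shiftBy-cong zero    F≈G = F≈G
  shiftBy-cong (suc j) F≈G = shift-cong (shiftBy-cong j F≈G)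

  shiftBy-vanishes : ∀ j {n F} → VanishesAbove n F → VanishesAbove (j +ℕ n) (shiftBy j F)
  shiftBy-vanishes zero    F≈0 = F≈0
  shiftBy-vanishes (suc j) F≈0 (suc k) (s≤s j+n<k) = shiftBy-vanishes j F≈0 k j+n<k

  sumTo-shift : ∀ n (F X : ℕ → Carrier) →
    sumTo (suc n) (λ k → shift F k * X k) ≈ sumTo n (λ k → F k * X (suc k))
  sumTo-shift n F X = trans (sumTo-suc-head n _) (trans (+-congʳ (zeroˡ (X 0))) (+-identityˡ _))

  poly : ℕ → (ℕ → Carrier) → Carrier → Carrier
  poly N F x = sumTo N (λ k → F k * x ^ k)

  poly-cong : ∀ N {F G} x → F ≋ G → poly N F x ≈ poly N G x
  poly-cong N x F≈G = sumTo-cong N (λ k → *-congʳ (F≈G k))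

  poly-pad : ∀ {m N F} x → VanishesAbove m F → m ≤ N → poly N F x ≈ poly m F x
  poly-pad x F≈0 = sumTo-pad _ (λ k m<k → trans (*-congʳ (F≈0 k m<k)) (zeroˡ _))

  poly-shiftBy : ∀ j N F x → poly (j +ℕ N) (shiftBy j F) x ≈ x ^ j * poly N F x
  poly-shiftBy zero    N F x = sym (*-identityˡ _)
  poly-shiftBy (suc j) N F x = begin
    poly (suc (j +ℕ N)) (shift (shiftBy j F)) x         ≈⟨ sumTo-shift (j +ℕ N) _ _ ⟩
    sumTo (j +ℕ N) (λ k → shiftBy j F k * (x * x ^ k))
      ≈⟨ sumTo-cong (j +ℕ N) (λ k → x∙yz≈y∙xz _ x _) ⟩
    sumTo (j +ℕ N) (λ k → x * (shiftBy j F k * x ^ k)) ≈⟨ *-distribˡ-sumTo (j +ℕ N) x _ ⟨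
    x * poly (j +ℕ N) (shiftBy j F) x                   ≈⟨ *-congˡ (poly-shiftBy j N F x) ⟩
    x * (x ^ j * poly N F x)                            ≈⟨ *-assoc x _ _ ⟨
    x ^ suc j * poly N F x                              ∎

  poly-linear : ∀ N l (a : ℕ → Carrier) (H : ℕ → ℕ → Carrier) x →
    poly N (λ m → sumTo l (λ j → a j * H j m)) x ≈ sumTo l (λ j → a j * poly N (H j) x)
  poly-linear N l a H x = begin
    sumTo N (λ m → sumTo l (λ j → a j * H j m) * x ^ m)
      ≈⟨ sumTo-cong N (λ m → trans (*-distribʳ-sumTo l _ _) (sumTo-cong l (λ j → *-assoc _ _ _))) ⟩
    sumTo N (λ m → sumTo l (λ j → a j * (H j m * x ^ m)))
      ≈⟨ sumTo-comm N l _ ⟩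
    sumTo l (λ j → sumTo N (λ m → a j * (H j m * x ^ m)))
      ≈⟨ sumTo-cong l (λ j → *-distribˡ-sumTo N _ _) ⟨
    sumTo l (λ j → a j * poly N (H j) x)
      ∎

  -- Multiplication by t - β in the basis (t)ₖ, using t (t)ₖ = (t)ₖ₊₁ + k (t)ₖ.
  mulLinear : Carrier → (ℕ → Carrier) → ℕ → Carrier
  mulLinear β F zero    = - β * F zero
  mulLinear β F (suc m) = F m + (ι (suc m) - β) * F (suc m)

  S-suc : ∀ β n → S β (suc n) ≋ mulLinear β (S β n)
  S-suc β n zero    = refl
  S-suc β n (suc m) = refl

  S-vanishes : ∀ β n → VanishesAbove n (S β n)
  S-vanishes β zero    (suc k) _         = refl
  S-vanishes β (suc n) (suc k) (s≤s n<k) = begin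
    S β n k + (ι (suc k) - β) * S β n (suc k)
      ≈⟨ +-cong (S-vanishes β n k n<k) (*-congˡ (S-vanishes β n (suc k) (ℕ.m<n⇒m<1+n n<k))) ⟩
    0# + (ι (suc k) - β) * 0#  ≈⟨ +-identityˡ _ ⟩
    (ι (suc k) - β) * 0#       ≈⟨ zeroʳ _ ⟩
    0#                         ∎

  mulLinear-cong : ∀ β {F G} → F ≋ G → mulLinear β F ≋ mulLinear β G
  mulLinear-cong β F≈G zero    = *-congˡ (F≈G zero)
  mulLinear-cong β F≈G (suc m) = +-cong (F≈G m) (*-congˡ (F≈G (suc m)))

  mulLinear-congˡ : ∀ {β β′} F → β ≈ β′ → mulLinear β F ≋ mulLinear β′ F
  mulLinear-congˡ F β≈β′ zero    = *-congʳ (-‿cong β≈β′)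
  mulLinear-congˡ F β≈β′ (suc m) = +-congˡ (*-congʳ (+-congˡ (-‿cong β≈β′)))

  mulLinear-linear : ∀ β l (a : ℕ → Carrier) (H : ℕ → ℕ → Carrier) →
    mulLinear β (λ i → sumTo l (λ j → a j * H j i)) ≋ (λ m → sumTo l (λ j → a j * mulLinear β (H j) m))
  mulLinear-linear β l a H zero = begin
    - β * sumTo l (λ j → a j * H j 0)      ≈⟨ *-distribˡ-sumTo l _ _ ⟩
    sumTo l (λ j → - β * (a j * H j 0))     ≈⟨ sumTo-cong l (λ j → x∙yz≈y∙xz _ _ _) ⟩
    sumTo l (λ j → a j * (- β * H j 0))     ∎
  mulLinear-linear β l a H (suc m) = begin
    sumTo l (λ j → a j * H j m) + b * sumTo l (λ j → a j * H j (suc m))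
      ≈⟨ +-congˡ (*-distribˡ-sumTo l _ _) ⟩
    sumTo l (λ j → a j * H j m) + sumTo l (λ j → b * (a j * H j (suc m)))
      ≈⟨ sumTo-+ l _ _ ⟨
    sumTo l (λ j → a j * H j m + b * (a j * H j (suc m)))
      ≈⟨ sumTo-cong l (λ j → trans (+-congˡ (x∙yz≈y∙xz _ _ _)) (sym (distribˡ _ _ _))) ⟩
    sumTo l (λ j → a j * (H j m + b * H j (suc m)))
      ∎
    where b = ι (suc m) - β

  mulLinear-shiftParam : ∀ β d F → mulLinear (β - d) F ≋ (λ m → mulLinear β F m + d * F m)
  mulLinear-shiftParam β d F zero = trans (*-congʳ (-[x-y]≈y-x β d))
    (solve 3 (λ b d f → ((d ⊕ ⊝ b) ⊗ f) ⊜ (⊝ b ⊗ f ⊕ d ⊗ f)) refl β d (F 0))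
  mulLinear-shiftParam β d F (suc m) = trans (+-congˡ (*-congʳ (+-congˡ (-[x-y]≈y-x β d))))
    (solve 5 (λ g i b d f → (g ⊕ (i ⊕ (d ⊕ ⊝ b)) ⊗ f) ⊜ (g ⊕ (i ⊕ ⊝ b) ⊗ f ⊕ d ⊗ f)) refl
      (F m) (ι (suc m)) β d (F (suc m)))

  mulLinear-shift : ∀ β F → mulLinear β (shift F) ≋ shift (mulLinear (β - 1#) F)
  mulLinear-shift β F zero          = zeroʳ _
  mulLinear-shift β F (suc zero)    =
    trans (+-identityˡ _) (*-congʳ (trans (+-congʳ (+-identityʳ 1#)) (sym (-[x-y]≈y-x β 1#))))
  mulLinear-shift β F (suc (suc m)) = +-congˡ (*-congʳ (begin
    (1# + i) - β      ≈⟨ solve 3 (λ o i b → ((o ⊕ i) ⊕ ⊝ b) ⊜ (i ⊕ (o ⊕ ⊝ b))) refl 1# i β ⟩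
    i + (1# - β)      ≈⟨ +-congˡ (-[x-y]≈y-x β 1#) ⟨
    i - (β - 1#)      ∎))
    where i = ι (suc m)

  mulLinear-shiftBy : ∀ β j F → mulLinear β (shiftBy j F) ≋ shiftBy j (mulLinear (β - ι j) F)
  mulLinear-shiftBy β zero    F = mulLinear-congˡ F (sym (trans (+-congˡ -0#≈0#) (+-identityʳ β)))
  mulLinear-shiftBy β (suc j) F m = begin
    mulLinear β (shift (shiftBy j F)) m
      ≈⟨ mulLinear-shift β _ m ⟩
    shift (mulLinear (β - 1#) (shiftBy j F)) m
      ≈⟨ shift-cong (mulLinear-shiftBy (β - 1#) j F) m ⟩
    shift (shiftBy j (mulLinear ((β - 1#) - ι j) F)) m
      ≈⟨ shift-cong (shiftBy-cong j (mulLinear-congˡ F β-1-j≈β-[1+j])) m ⟩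
    shift (shiftBy j (mulLinear (β - ι (suc j)) F)) m
      ∎
    where
    β-1-j≈β-[1+j] : (β - 1#) - ι j ≈ β - ι (suc j)
    β-1-j≈β-[1+j] = solve 3 (λ b o i → ((b ⊕ ⊝ o) ⊕ ⊝ i) ⊜ (b ⊕ ⊝ (o ⊕ i))) refl β 1# (ι j)

  -- Whatever β is, S β 0 is the unit sequence at 0, so shiftBy j (S β 0) is the unit sequence at j.
  sumTo-sift : ∀ l (a β : ℕ → Carrier) m → VanishesAbove l a →
    sumTo l (λ j → a j * shiftBy j (S (β j) 0) m) ≈ a m
  sumTo-sift zero    a β zero    a≈0 = *-identityʳ (a 0)
  sumTo-sift zero    a β (suc m) a≈0 = trans (zeroʳ (a 0)) (sym (a≈0 (suc m) (s≤s z≤n)))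
  sumTo-sift (suc l) a β zero    a≈0 = begin
    sumTo (suc l) (λ j → a j * shiftBy j (S (β j) 0) 0) ≈⟨ sumTo-suc-head l _ ⟩
    a 0 * 1# + sumTo l (λ j → a (suc j) * 0#)
      ≈⟨ +-cong (*-identityʳ (a 0)) (sumTo-zero l (λ j _ → zeroʳ _)) ⟩
    a 0 + 0#                                            ≈⟨ +-identityʳ (a 0) ⟩
    a 0                                                 ∎
  sumTo-sift (suc l) a β (suc m) a≈0 = begin
    sumTo (suc l) (λ j → a j * shiftBy j (S (β j) 0) (suc m))
      ≈⟨ sumTo-suc-head l _ ⟩
    a 0 * 0# + sumTo l (λ j → a (suc j) * shiftBy j (S (β (suc j)) 0) m)
      ≈⟨ +-cong (zeroʳ (a 0)) (sumTo-sift l (λ j → a (suc j)) (λ j → β (suc j)) m a∘suc≈0) ⟩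
    0# + a (suc m)
      ≈⟨ +-identityˡ _ ⟩
    a (suc m) ∎
    where
    a∘suc≈0 : VanishesAbove l (λ j → a (suc j))
    a∘suc≈0 k l<k = a≈0 (suc k) (s≤s l<k)

  -- S_α(n + l, m) = Σⱼ S_α(l, j) S_{α-j}(n, m - j), with S_{α-j}(n, m - j) = 0 for m < j.
  S-convolution : ∀ α l n →
    S α (n +ℕ l) ≋ (λ m → sumTo l (λ j → S α l j * shiftBy j (S (α - ι j) n) m))
  S-convolution α l zero    m = sym (sumTo-sift l (S α l) (λ j → α - ι j) m (S-vanishes α l))
  S-convolution α l (suc n) m = begin
    S α (suc (n +ℕ l)) m
      ≈⟨ S-suc α (n +ℕ l) m ⟩
    mulLinear α (S α (n +ℕ l)) m
      ≈⟨ mulLinear-cong α (S-convolution α l n) m ⟩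
    mulLinear α (λ i → sumTo l (λ j → S α l j * shiftBy j (S (α - ι j) n) i)) m
      ≈⟨ mulLinear-linear α l (S α l) (λ j → shiftBy j (S (α - ι j) n)) m ⟩
    sumTo l (λ j → S α l j * mulLinear α (shiftBy j (S (α - ι j) n)) m)
      ≈⟨ sumTo-cong l (λ j → *-congˡ (mulLinear-shiftBy α j _ m)) ⟩
    sumTo l (λ j → S α l j * shiftBy j (mulLinear (α - ι j) (S (α - ι j) n)) m)
      ≈⟨ sumTo-cong l (λ j → *-congˡ (shiftBy-cong j (λ i → sym (S-suc (α - ι j) n i)) m)) ⟩
    sumTo l (λ j → S α l j * shiftBy j (S (α - ι j) (suc n)) m)
      ∎

  ι-^ : ∀ m e → ι (m ^ℕ e) ≈ ι m ^ e
  ι-^ m zero    = +-identityʳ 1#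
  ι-^ m (suc e) = trans (×1-homo-* m (m ^ℕ e)) (*-congˡ (ι-^ m e))

  ι-C-vanishes : ∀ {n k} → n < k → ι (n C k) ≈ 0#
  ι-C-vanishes n<k = reflexive (≡.cong ι (k>n⇒nCk≡0 n<k))

  binomialTerm : Carrier → ℕ → ℕ → Carrier
  binomialTerm d n k = ι (n C k) * d ^ (n ∸ k)

  binomialTerm-vanishes : ∀ d n → VanishesAbove n (binomialTerm d n)
  binomialTerm-vanishes d n k n<k = trans (*-congʳ (ι-C-vanishes n<k)) (zeroˡ _)

  binomialTerm-zero : ∀ d n → binomialTerm d n 0 ≈ d ^ n
  binomialTerm-zero d n = trans (*-congʳ (+-identityʳ 1#)) (*-identityˡ _)

  binomialTerm-suc : ∀ d n →
    binomialTerm d (suc n) ≋ (λ k → shift (binomialTerm d n) k + d * binomialTerm d n k)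
  binomialTerm-suc d n zero    = begin
    binomialTerm d (suc n) 0       ≈⟨ binomialTerm-zero d (suc n) ⟩
    d * d ^ n                      ≈⟨ *-congˡ (binomialTerm-zero d n) ⟨
    d * binomialTerm d n 0         ≈⟨ +-identityˡ _ ⟨
    0# + d * binomialTerm d n 0    ∎
  binomialTerm-suc d n (suc k) = begin
    ι (suc n C suc k) * d ^ (n ∸ k)
      ≈⟨ *-congʳ (reflexive (≡.cong ι (≡.sym (nCk+nC[k+1]≡[n+1]C[k+1] n k)))) ⟩
    ι (n C k +ℕ n C suc k) * d ^ (n ∸ k)
      ≈⟨ trans (*-congʳ (×-homo-+ 1# (n C k) (n C suc k))) (distribʳ _ _ _) ⟩
    binomialTerm d n k + ι (n C suc k) * d ^ (n ∸ k)
      ≈⟨ +-congˡ pascal-tail ⟩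
    binomialTerm d n k + d * binomialTerm d n (suc k)
      ∎
    where
    pascal-tail : ι (n C suc k) * d ^ (n ∸ k) ≈ d * binomialTerm d n (suc k)
    pascal-tail with ℕ.<-≤-connex k n
    -- (1 + n) ∸ suc k reduces to n ∸ k, so this rewrites d ^ (n ∸ k) to d * d ^ (n ∸ suc k).
    ... | inj₁ k<n rewrite ℕ.+-∸-assoc 1 k<n = x∙yz≈y∙xz _ d _
    ... | inj₂ n≤k = begin
      ι (n C suc k) * d ^ (n ∸ k)      ≈⟨ trans (*-congʳ (ι-C-vanishes (s≤s n≤k))) (zeroˡ _) ⟩
      0#                              ≈⟨ zeroʳ d ⟨
      d * 0#                          ≈⟨ *-congˡ (binomialTerm-vanishes d n (suc k) (s≤s n≤k)) ⟨
      d * binomialTerm d n (suc k)    ∎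

  sumTo-pascal : ∀ n d (a a′ X : ℕ → Carrier) →
    a (suc n) ≈ 0# → a′ ≋ (λ k → shift a k + d * a k) →
    sumTo n (λ k → a k * (X (suc k) + d * X k)) ≈ sumTo (suc n) (λ k → a′ k * X k)
  sumTo-pascal n d a a′ X a[1+n]≈0 a′≈ = begin
    sumTo n (λ k → a k * (X (suc k) + d * X k))
      ≈⟨ sumTo-cong n (λ k → solve 4 (λ a x y d → (a ⊗ (x ⊕ d ⊗ y)) ⊜ (a ⊗ x ⊕ d ⊗ a ⊗ y)) refl
                                 (a k) (X (suc k)) (X k) d) ⟩
    sumTo n (λ k → a k * X (suc k) + d * a k * X k)
      ≈⟨ sumTo-+ n _ _ ⟩
    sumTo n (λ k → a k * X (suc k)) + sumTo n (λ k → d * a k * X k)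
      ≈⟨ +-cong (sumTo-shift n a X) dropLast ⟨
    sumTo (suc n) (λ k → shift a k * X k) + sumTo (suc n) (λ k → d * a k * X k)
      ≈⟨ sumTo-+ (suc n) _ _ ⟨
    sumTo (suc n) (λ k → shift a k * X k + d * a k * X k)
      ≈⟨ sumTo-cong (suc n) (λ k → trans (sym (distribʳ _ _ _)) (*-congʳ (sym (a′≈ k)))) ⟩
    sumTo (suc n) (λ k → a′ k * X k)
      ∎
    where
    dropLast : sumTo (suc n) (λ k → d * a k * X k) ≈ sumTo n (λ k → d * a k * X k)
    dropLast = trans (+-congˡ (trans (*-congʳ (trans (*-congˡ a[1+n]≈0) (zeroʳ d))) (zeroˡ _)))
                     (+-identityʳ _)

  -- The binomial theorem for (t - α + d)ⁿ = ((t - α) + d)ⁿ, in the basis (t)ₖ.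
  S-shiftParam : ∀ α d n → S (α - d) n ≋ (λ i → sumTo n (λ k → binomialTerm d n k * S α k i))
  S-shiftParam α d zero zero    = sym (trans (*-identityʳ _) (binomialTerm-zero d 0))
  S-shiftParam α d zero (suc i) = sym (zeroʳ _)
  S-shiftParam α d (suc n) i = begin
    S (α - d) (suc n) i
      ≈⟨ S-suc (α - d) n i ⟩
    mulLinear (α - d) (S (α - d) n) i
      ≈⟨ mulLinear-cong (α - d) (S-shiftParam α d n) i ⟩
    mulLinear (α - d) (λ i → sumTo n (λ k → binomialTerm d n k * S α k i)) i
      ≈⟨ mulLinear-linear (α - d) n (binomialTerm d n) (S α) i ⟩
    sumTo n (λ k → binomialTerm d n k * mulLinear (α - d) (S α k) i)
      ≈⟨ sumTo-cong n (λ k → *-congˡ (trans (mulLinear-shiftParam α d (S α k) i)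
                                            (+-congʳ (sym (S-suc α k i))))) ⟩
    sumTo n (λ k → binomialTerm d n k * (S α (suc k) i + d * S α k i))
      ≈⟨ sumTo-pascal n d (binomialTerm d n) (binomialTerm d (suc n)) (λ k → S α k i)
           (binomialTerm-vanishes d n (suc n) ℕ.≤-refl) (binomialTerm-suc d n) ⟩
    sumTo (suc n) (λ k → binomialTerm d (suc n) k * S α k i)
      ∎

  bellPoly-shiftParam : ∀ α d n x →
    bellPoly (α - d) n x ≈ sumTo n (λ k → binomialTerm d n k * bellPoly α k x)
  bellPoly-shiftParam α d n x = begin
    poly n (S (α - d) n) x
      ≈⟨ poly-cong n x (S-shiftParam α d n) ⟩
    poly n (λ i → sumTo n (λ k → binomialTerm d n k * S α k i)) x
      ≈⟨ poly-linear n n (binomialTerm d n) (S α) x ⟩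
    sumTo n (λ k → binomialTerm d n k * poly n (S α k) x)
      ≈⟨ sumTo-congᵇ n (λ k k≤n → *-congˡ (poly-pad x (S-vanishes α k) k≤n)) ⟩
    sumTo n (λ k → binomialTerm d n k * bellPoly α k x)
      ∎

  bellPoly-+ : ∀ α x n l →
    bellPoly α (n +ℕ l) x ≈ sumTo l (λ j → S α l j * (x ^ j * bellPoly (α - ι j) n x))
  bellPoly-+ α x n l = begin
    poly (n +ℕ l) (S α (n +ℕ l)) x
      ≈⟨ poly-cong (n +ℕ l) x (S-convolution α l n) ⟩
    poly (n +ℕ l) (λ m → sumTo l (λ j → S α l j * shiftBy j (S (α - ι j) n) m)) x
      ≈⟨ poly-linear (n +ℕ l) l (S α l) (λ j → shiftBy j (S (α - ι j) n)) x ⟩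
    sumTo l (λ j → S α l j * poly (n +ℕ l) (shiftBy j (S (α - ι j) n)) x)
      ≈⟨ sumTo-congᵇ l (λ j j≤l → *-congˡ (poly-shiftBy-pad j j≤l)) ⟩
    sumTo l (λ j → S α l j * (x ^ j * bellPoly (α - ι j) n x))
      ∎
    where
    poly-shiftBy-pad : ∀ j → j ≤ l →
      poly (n +ℕ l) (shiftBy j (S (α - ι j) n)) x ≈ x ^ j * bellPoly (α - ι j) n x
    poly-shiftBy-pad j j≤l = trans
      (poly-pad x (shiftBy-vanishes j (S-vanishes (α - ι j) n))
        (ℕ.≤-trans (ℕ.≤-reflexive (ℕ.+-comm j n)) (ℕ.+-monoʳ-≤ n j≤l)))
      (poly-shiftBy j n (S (α - ι j) n) x)

  bellPoly-+-binomial : ∀ α x n l → bellPoly α (n +ℕ l) x ≈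
    sumTo l (λ j → sumTo n (λ k → S α l j * (ι ((n C k) *ℕ (j ^ℕ (n ∸ k))) * (bellPoly α k x * x ^ j))))
  bellPoly-+-binomial α x n l = trans (bellPoly-+ α x n l) (sumTo-cong l expand)
    where
    expand : ∀ j → S α l j * (x ^ j * bellPoly (α - ι j) n x) ≈
      sumTo n (λ k → S α l j * (ι ((n C k) *ℕ (j ^ℕ (n ∸ k))) * (bellPoly α k x * x ^ j)))
    expand j = begin
      S α l j * (x ^ j * bellPoly (α - ι j) n x)
        ≈⟨ *-congˡ (*-congˡ (bellPoly-shiftParam α (ι j) n x)) ⟩
      S α l j * (x ^ j * sumTo n (λ k → binomialTerm (ι j) n k * bellPoly α k x))
        ≈⟨ *-congˡ (*-distribˡ-sumTo n _ _) ⟩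
      S α l j * sumTo n (λ k → x ^ j * (binomialTerm (ι j) n k * bellPoly α k x))
        ≈⟨ *-distribˡ-sumTo n _ _ ⟩
      sumTo n (λ k → S α l j * (x ^ j * (binomialTerm (ι j) n k * bellPoly α k x)))
        ≈⟨ sumTo-cong n (λ k → *-congˡ (trans (x∙yz≈y∙xz _ _ _)
                                              (*-cong (sym (ι-binomial k)) (*-comm _ _)))) ⟩
      sumTo n (λ k → S α l j * (ι ((n C k) *ℕ (j ^ℕ (n ∸ k))) * (bellPoly α k x * x ^ j)))
        ∎
      where
      ι-binomial : ∀ k → ι ((n C k) *ℕ (j ^ℕ (n ∸ k))) ≈ binomialTerm (ι j) n k
      ι-binomial k = trans (×1-homo-* (n C k) _) (*-congˡ (ι-^ j (n ∸ k)))

  1#^n≈1# : ∀ n → 1# ^ n ≈ 1#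
  1#^n≈1# zero    = refl
  1#^n≈1# (suc n) = trans (*-identityˡ _) (1#^n≈1# n)

  bell≈bellPoly-1# : ∀ α n → bell α n ≈ bellPoly α n 1#
  bell≈bellPoly-1# α n = sumTo-cong n (λ k → sym (trans (*-congˡ (1#^n≈1# k)) (*-identityʳ _)))

  bell-+-binomial : ∀ α n l → bell α (n +ℕ l) ≈
    sumTo l (λ j → sumTo n (λ k → S α l j * (ι ((n C k) *ℕ (j ^ℕ (n ∸ k))) * bell α k)))
  bell-+-binomial α n l = begin
    bell α (n +ℕ l)           ≈⟨ bell≈bellPoly-1# α (n +ℕ l) ⟩
    bellPoly α (n +ℕ l) 1#    ≈⟨ bellPoly-+-binomial α 1# n l ⟩
    sumTo l (λ j → sumTo n (λ k → S α l j * (ι ((n C k) *ℕ (j ^ℕ (n ∸ k))) * (bellPoly α k 1# * 1# ^ j))))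
      ≈⟨ sumTo-cong l (λ j → sumTo-cong n (λ k → *-congˡ (*-congˡ (bellPoly-1#≈bell k j)))) ⟩
    sumTo l (λ j → sumTo n (λ k → S α l j * (ι ((n C k) *ℕ (j ^ℕ (n ∸ k))) * bell α k)))
      ∎
    where
    bellPoly-1#≈bell : ∀ k j → bellPoly α k 1# * 1# ^ j ≈ bell α k
    bellPoly-1#≈bell k j = trans (*-cong (sym (bell≈bellPoly-1# α k)) (1#^n≈1# j)) (*-identityʳ _)

corollary4 : ∀ {c ℓ' : Level} (R : CommutativeRing c ℓ') →
    let open CommutativeRing R renaming (_*_ to _·_)
        open NonCentral R
    in (α x : Carrier) (n l : ℕ) →
      (bellPoly α (n +ℕ l) x ≈
        sumTo l (λ j → sumTo n (λ k →
          S α l j · (ι ((n C k) *ℕ (j ^ℕ (n ∸ k))) · (bellPoly α k x · (x ^ j))))))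
      × (bell α (n +ℕ l) ≈
        sumTo l (λ j → sumTo n (λ k →
          S α l j · (ι ((n C k) *ℕ (j ^ℕ (n ∸ k))) · bell α k))))
corollary4 R α x n l = bellPoly-+-binomial α x n l , bell-+-binomial α n l
  where open NonCentralProperties R
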